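{- Let $q$ be a prime power, $n\ge1$, $t\ge1$, and let $B_n(q)$ be the lattice of subspaces of $\mathbb F_q^n$ ordered by inclusion. Label each cover relation $X\lessdot Y$ of $B_n(q)$ by the unique element of $f(A(Y))\setminus f(A(X))$, and label each cover relation $(X_1,\ldots,X_t)\lessdot(Y_1,\ldots,Y_t)$ of the $t$-fold Segre power $B_n^{(t)}(q)$ by the $t$-tuple $(\lambda_1,\ldots,\lambda_t)\in[n]^t$, where $\lambda_i$ is the label of $X_i\lessdot Y_i$. With labels ordered componentwise in $[n]^t$, this edge labeling of $B_n^{(t)}(q)$ is an EL-labeling.
   Context: $A$ is the set of 1-dimensional subspaces of $\mathbb F_q^n$; for $X\in B_n(q)$, $A(X)=\{V\in A: V\subseteq X\}$. The map $f:A\to[n]$ sends $V=\mathrm{span}\{v\}$ to the largest index $i$ with $v_i\neq0$. (For a cover $X\lessdot Y$, $f(A(Y))\setminus f(A(X))$ has exactly one element.) The $t$-fold Segre power $B_n^{(t)}(q)$ ($t\ge2$) is the induced subposet of the $t$-fold product $B_n(q)\times\cdots\times B_n(q)$ (componentwise order) consisting of tuples of subspaces all of the same dimension; its covers are tuples $X\lessdot Y$ with $X_i\lessdot Y_i$ for all $i$; for $t=1$ it is $B_n(q)$. The componentwise order on $[n]^t$: $(a_1,\ldots,a_t)\le(b_1,\ldots,b_t)$ iff $a_i\le b_i$ for all $i$. An edge labeling is an EL-labeling if in every interval $[x,y]$ there is a unique maximal chain whose consecutive labels strictly increase, and its label sequence lexicographically strictly precedes the label sequence of every other maximal chain in $[x,y]$.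 -}

module Defs where

open import Level using (Level; _⊔_) renaming (suc to lsuc)
open import Algebra.Bundles using (CommutativeRing)
open import Data.Nat as ℕ using (ℕ; _^_)
open import Data.Nat.Primality using (Prime)
open import Data.Fin as Fin using (Fin)
open import Data.List using (List; []; _∷_)
open import Data.Product using (Σ; ∃; ∃-syntax; _×_; _,_)
open import Data.Empty using (⊥)
open import Data.Unit using (⊤)
open import Relation.Nullary using (¬_)
open import Relation.Binary.PropositionalEquality using (_≡_)

IsPrimePower : ℕ → Set
IsPrimePower q = ∃[ p ] ∃[ k ] (Prime p × 1 ℕ.≤ k × q ≡ p ^ k)

record FiniteField (c ℓ : Level) : Set (lsuc (c ⊔ ℓ)) where
  field
    commRing : CommutativeRing c ℓ
  open CommutativeRing commRing public
  field
    0≉1      : ¬ (0# ≈ 1#)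
    inverse  : ∀ x → ¬ (x ≈ 0#) → ∃[ y ] (x * y ≈ 1#)
    size     : ℕ
    enum     : Fin size → Carrier
    enum-inj : ∀ i j → enum i ≈ enum j → i ≡ j
    enum-sur : ∀ x → ∃[ i ] (enum i ≈ x)

module Over {c ℓ : Level} (F : FiniteField c ℓ) (n t : ℕ) where
  open FiniteField F

  -- vectors of F^n (coordinates indexed by Fin n; index i ↔ i+1 ∈ [n])
  Vect : Set c
  Vect = Fin n → Carrier

  _≋_ : Vect → Vect → Set ℓ
  u ≋ v = ∀ i → u i ≈ v i

  0v : Vect
  0v _ = 0#

  _+v_ : Vect → Vect → Vect
  (u +v v) i = u i + v i

  _·v_ : Carrier → Vect → Vect
  (a ·v v) i = a * v i

  lincomb : ∀ {d} → (Fin d → Carrier) → (Fin d → Vect) → Vect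
  lincomb {ℕ.zero}  a b = 0v
  lincomb {ℕ.suc d} a b = (a Fin.zero ·v b Fin.zero)
                          +v lincomb (λ k → a (Fin.suc k)) (λ k → b (Fin.suc k))

  record Subspace : Set (lsuc (c ⊔ ℓ)) where
    field
      mem     : Vect → Set (c ⊔ ℓ)
      mem-resp : ∀ {u v} → u ≋ v → mem u → mem v
      mem-0   : mem 0v
      mem-+   : ∀ {u v} → mem u → mem v → mem (u +v v)
      mem-·   : ∀ a {v} → mem v → mem (a ·v v)
  open Subspace public

  _⊆_ : Subspace → Subspace → Set (c ⊔ ℓ)
  X ⊆ Y = ∀ v → mem X v → mem Y v

  _≐_ : Subspace → Subspace → Set (c ⊔ ℓ)
  X ≐ Y = (X ⊆ Y) × (Y ⊆ X)

  span : ∀ {d} → (Fin d → Vect) → Subspace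
  span b = record
    { mem = λ w → ∃[ a ] (w ≋ lincomb a b)
    ; mem-resp = λ {u} {v} u≋v (a , p) → a , λ i → trans (sym (u≋v i)) (p i)
    ; mem-0 = (λ _ → 0#) , λ i → sym (lc0 b i)
    ; mem-+ = λ (a , p) (a' , p') → (λ k → a k + a' k) ,
                λ i → trans (+-cong (p i) (p' i)) (sym (lc+ a a' b i))
    ; mem-· = λ x (a , p) → (λ k → x * a k) ,
                λ i → trans (*-cong refl (p i)) (sym (lc· x a b i))
    }
    where
    open import Relation.Binary.Reasoning.Setoid setoid
    lc0 : ∀ {d} (b : Fin d → Vect) → lincomb (λ _ → 0#) b ≋ 0v
    lc0 {ℕ.zero} b i = refl
    lc0 {ℕ.suc d} b i = trans (+-cong (zeroˡ (b Fin.zero i)) (lc0 (λ k → b (Fin.suc k)) i)) (+-identityˡ 0#)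
    lc+ : ∀ {d} (a a' : Fin d → Carrier) (b : Fin d → Vect) →
          lincomb (λ k → a k + a' k) b ≋ (lincomb a b +v lincomb a' b)
    lc+ {ℕ.zero} a a' b i = sym (+-identityˡ 0#)
    lc+ {ℕ.suc d} a a' b i = begin
        (a Fin.zero + a' Fin.zero) * b Fin.zero i + R (λ k → a (Fin.suc k) + a' (Fin.suc k))
      ≈⟨ +-cong (distribʳ _ _ _) (lc+ (λ k → a (Fin.suc k)) (λ k → a' (Fin.suc k)) (λ k → b (Fin.suc k)) i) ⟩
        (x + x') + (R (λ k → a (Fin.suc k)) + R (λ k → a' (Fin.suc k)))
      ≈⟨ +-assoc x x' _ ⟩
        x + (x' + (R (λ k → a (Fin.suc k)) + R (λ k → a' (Fin.suc k))))
      ≈⟨ +-cong refl (trans (sym (+-assoc x' _ _)) (trans (+-cong (+-comm x' _) refl) (+-assoc _ x' _))) ⟩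
        x + (R (λ k → a (Fin.suc k)) + (x' + R (λ k → a' (Fin.suc k))))
      ≈⟨ sym (+-assoc x _ _) ⟩
        (x + R (λ k → a (Fin.suc k))) + (x' + R (λ k → a' (Fin.suc k)))
      ∎
      where
      R : (Fin d → Carrier) → Carrier
      R c = lincomb c (λ k → b (Fin.suc k)) i
      x  = a Fin.zero * b Fin.zero i
      x' = a' Fin.zero * b Fin.zero i
    lc· : ∀ {d} (x : Carrier) (a : Fin d → Carrier) (b : Fin d → Vect) →
          lincomb (λ k → x * a k) b ≋ (x ·v lincomb a b)
    lc· {ℕ.zero} x a b i = sym (zeroʳ x)
    lc· {ℕ.suc d} x a b i =
      trans (+-cong (*-assoc x (a Fin.zero) (b Fin.zero i))
                    (lc· x (λ k → a (Fin.suc k)) (λ k → b (Fin.suc k)) i))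
            (sym (distribˡ x _ _))

  LinIndep : ∀ {d} → (Fin d → Vect) → Set (c ⊔ ℓ)
  LinIndep b = ∀ a → lincomb a b ≋ 0v → ∀ k → a k ≈ 0#

  HasDim : Subspace → ℕ → Set (c ⊔ ℓ)
  HasDim X d = Σ (Fin d → Vect) λ b → LinIndep b × (X ≐ span b)

  -- A = 1-dimensional subspaces;  A(X) = those contained in X
  InA : Subspace → Set (c ⊔ ℓ)
  InA V = HasDim V 1

  -- f(V) = i : V = span{v} and i is the largest index with v_i ≠ 0
  LastNonzero : Vect → Fin n → Set ℓ
  LastNonzero v i = ¬ (v i ≈ 0#) × (∀ j → i Fin.< j → v j ≈ 0#)

  f-is : Subspace → Fin n → Set (c ⊔ ℓ)
  f-is V i = ∃[ v ] (¬ (v ≋ 0v) × (V ≐ span (λ (_ : Fin 1) → v)) × LastNonzero v i)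

  _∈fA_ : Fin n → Subspace → Set (lsuc (c ⊔ ℓ))
  i ∈fA X = ∃[ V ] (InA V × V ⊆ X × f-is V i)

  BLabel : Subspace → Subspace → Fin n → Set (lsuc (c ⊔ ℓ))
  BLabel X Y i = (i ∈fA Y) × ¬ (i ∈fA X)

  -- The t-fold Segre power B_n^(t)(q): t-tuples of subspaces of a common
  -- dimension, ordered componentwise (for t = 1 this is B_n(q)).

  record Seg : Set (lsuc (c ⊔ ℓ)) where
    field
      comp : Fin t → Subspace
      dim  : ℕ
      dims : ∀ i → HasDim (comp i) dim
  open Seg public

  _≤S_ : Seg → Seg → Set (c ⊔ ℓ)
  x ≤S y = ∀ i → comp x i ⊆ comp y i

  _≐S_ : Seg → Seg → Set (c ⊔ ℓ)
  x ≐S y = (x ≤S y) × (y ≤S x)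

  _<S_ : Seg → Seg → Set (c ⊔ ℓ)
  x <S y = (x ≤S y) × ¬ (y ≤S x)

  _⋖S_ : Seg → Seg → Set (lsuc (c ⊔ ℓ))
  x ⋖S y = (x <S y) × ¬ (∃[ z ] (x <S z × z <S y))

  Label : Set
  Label = Fin t → Fin n

  _≗L_ : Label → Label → Set
  a ≗L b = ∀ i → a i ≡ b i

  _≤L_ : Label → Label → Set
  a ≤L b = ∀ i → a i Fin.≤ b i

  _<L_ : Label → Label → Set
  a <L b = (a ≤L b) × ¬ (a ≗L b)

  SegLabel : Seg → Seg → Label → Set (lsuc (c ⊔ ℓ))
  SegLabel x y λ' = ∀ i → BLabel (comp x i) (comp y i) (λ' i)

  -- maximal chains of an interval [x,y]: x = z₀ ⋖ z₁ ⋖ ⋯ ⋖ z_k ≐ y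

  data Chain : Seg → Seg → Set (lsuc (c ⊔ ℓ)) where
    stop : ∀ {x y} → x ≐S y → Chain x y
    step : ∀ {x y} (z : Seg) → x ⋖S z → Chain z y → Chain x y

  SameChain : ∀ {x y x' y'} → Chain x y → Chain x' y' → Set (c ⊔ ℓ)
  SameChain (stop _)     (stop _)       = Lift⊤
    where Lift⊤ = Level.Lift (c ⊔ ℓ) ⊤
  SameChain (stop _)     (step _ _ _)   = Level.Lift (c ⊔ ℓ) ⊥
  SameChain (step _ _ _) (stop _)       = Level.Lift (c ⊔ ℓ) ⊥
  SameChain (step z _ r) (step z' _ r') = (z ≐S z') × SameChain r r'

  data LabelSeq (Lab : Seg → Seg → Label → Set (lsuc (c ⊔ ℓ)))
       : ∀ {x y} → Chain x y → List Label → Set (lsuc (c ⊔ ℓ)) where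
    ls-stop : ∀ {x y} {e : x ≐S y} → LabelSeq Lab {x} {y} (stop e) []
    ls-step : ∀ {x y z} {e : x ⋖S z} {r : Chain z y} {a ls} →
           Lab x z a → LabelSeq Lab {z} {y} r ls → LabelSeq Lab {x} {y} (step z e r) (a ∷ ls)

  Increasing : List Label → Set
  Increasing []            = ⊤
  Increasing (a ∷ [])      = ⊤
  Increasing (a ∷ b ∷ ls)  = (a <L b) × Increasing (b ∷ ls)

  data LexLt : List Label → List Label → Set where
    halt : ∀ {b bs} → LexLt [] (b ∷ bs)
    this : ∀ {a b as bs} → a <L b → LexLt (a ∷ as) (b ∷ bs)
    next : ∀ {a b as bs} → a ≗L b → LexLt as bs → LexLt (a ∷ as) (b ∷ bs)

  IsELLabeling : (Seg → Seg → Label → Set (lsuc (c ⊔ ℓ))) → Set (lsuc (c ⊔ ℓ))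
  IsELLabeling Lab =
    ∀ x y → x ≤S y →
    Σ (Chain x y) λ ch → Σ (List Label) λ ls →
      LabelSeq Lab ch ls × Increasing ls
      × (∀ (ch' : Chain x y) ls' → LabelSeq Lab ch' ls' → Increasing ls' → SameChain ch ch')
      × (∀ (ch' : Chain x y) ls' → LabelSeq Lab ch' ls' → ¬ SameChain ch ch' → LexLt ls ls')

-- Call j a pivot of a subspace X when some vector of X has its last nonzero coordinate at j; the
-- pivots of X are f(A(X)). Gaussian elimination from the top coordinate shows that X ⊆ Y with no
-- new pivot forces X = Y, and that adjoining one vector to a basis creates exactly one new pivot;
-- hence dim X is the number of pivots, and a cover X ⋖ Y of B_n(q) has a unique new pivot, its label.
-- In [x, y] ⊆ B_n^(t)(q) the increasing chain is built greedily: in each component adjoin to X_i a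
-- vector of Y_i whose pivot is the least new pivot a_i of Y_i over X_i. Every new pivot of y_i over
-- x_i occurs as an i-th label of any maximal chain, so the first label of any chain is ≥ a, and
-- equals a when the chain is increasing. A subspace between X_i and Y_i with pivot a_i contains the
-- greedy extension, so the first label determines the first step; induction on dim y - dim x then
-- gives uniqueness and lexicographic minimality.

module Submission where

open import Defs
open import Data.Nat using (ℕ; _≤_)
open import Relation.Binary.PropositionalEquality using (_≡_)

open import Level using (_⊔_; lift)
open import Data.Nat as ℕ using (zero; suc; _<_; z≤n; s≤s)
import Data.Nat.Properties as ℕ
open import Data.Fin as Fin using (Fin; toℕ; fromℕ<)
import Data.Fin.Properties as Fin
open import Data.Product using (∃; ∃-syntax; _×_; _,_; proj₁; proj₂)
open import Data.Sum using (_⊎_; inj₁; inj₂; [_,_])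
open import Data.Empty using (⊥; ⊥-elim)
open import Data.Unit using (tt)
open import Data.List using (List; []; _∷_)
open import Data.List.Relation.Unary.Any using (Any; here; there)
open import Function using (_∘_)
open import Data.Vec.Functional using (head; tail) renaming (_∷_ to _∷ᵥ_)
open import Relation.Nullary using (¬_; Dec; yes; no; contradiction)
open import Relation.Nullary.Decidable using (map′; ¬?; _×-dec_; _⊎-dec_; _→-dec_; decidable-stable)
open import Relation.Unary using (Pred; Decidable)
open import Relation.Binary using (tri<; tri≈; tri>)
open import Relation.Binary.PropositionalEquality as ≡ using (_≢_)

indicator : ∀ {a} {A : Set a} → Dec A → ℕ
indicator (yes _) = 1
indicator (no _)  = 0

module _ {a b} {A : Set a} {B : Set b} where

  indicator-mono : (A → B) → (A? : Dec A) (B? : Dec B) → indicator A? ≤ indicator B?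
  indicator-mono A⇒B (yes _) (yes _) = s≤s z≤n
  indicator-mono A⇒B (yes x) (no ¬y) = contradiction (A⇒B x) ¬y
  indicator-mono A⇒B (no _)  _       = z≤n

  indicator-mono-< : B → ¬ A → (A? : Dec A) (B? : Dec B) → indicator A? < indicator B?
  indicator-mono-< y ¬x (yes x) _       = contradiction x ¬x
  indicator-mono-< y ¬x (no _)  (yes _) = s≤s z≤n
  indicator-mono-< y ¬x (no _)  (no ¬y) = contradiction y ¬y

indicator≤1 : ∀ {a} {A : Set a} (A? : Dec A) → indicator A? ≤ 1
indicator≤1 (yes _) = s≤s z≤n
indicator≤1 (no _)  = z≤n

count : ∀ {n p} {P : Pred (Fin n) p} → Decidable P → ℕ
count {zero}  P? = 0
count {suc n} P? = indicator (P? Fin.zero) ℕ.+ count (P? ∘ Fin.suc)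

count-mono : ∀ {n p q} {P : Pred (Fin n) p} {Q : Pred (Fin n) q} (P? : Decidable P) (Q? : Decidable Q) →
             (∀ {i} → P i → Q i) → count P? ≤ count Q?
count-mono {zero}  P? Q? P⇒Q = z≤n
count-mono {suc n} P? Q? P⇒Q =
  ℕ.+-mono-≤ (indicator-mono P⇒Q (P? Fin.zero) (Q? Fin.zero)) (count-mono (P? ∘ Fin.suc) (Q? ∘ Fin.suc) P⇒Q)

count-mono-< : ∀ {n p q} {P : Pred (Fin n) p} {Q : Pred (Fin n) q} (P? : Decidable P) (Q? : Decidable Q) →
               (∀ {i} → P i → Q i) → ∀ {a} → Q a → ¬ P a → count P? < count Q?
count-mono-< {suc n} P? Q? P⇒Q {Fin.zero} Qa ¬Pa =
  ℕ.+-mono-<-≤ (indicator-mono-< Qa ¬Pa (P? Fin.zero) (Q? Fin.zero))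
               (count-mono (P? ∘ Fin.suc) (Q? ∘ Fin.suc) P⇒Q)
count-mono-< {suc n} P? Q? P⇒Q {Fin.suc a} Qa ¬Pa =
  ℕ.+-mono-≤-< (indicator-mono P⇒Q (P? Fin.zero) (Q? Fin.zero))
               (count-mono-< (P? ∘ Fin.suc) (Q? ∘ Fin.suc) P⇒Q Qa ¬Pa)

count-≤-suc : ∀ {n p q} {P : Pred (Fin n) p} {Q : Pred (Fin n) q} (P? : Decidable P) (Q? : Decidable Q) →
              ∀ a → (∀ {i} → Q i → P i ⊎ i ≡ a) → count Q? ≤ suc (count P?)
count-≤-suc {suc n} P? Q? Fin.zero Q⇒P⊎a =
  ℕ.+-mono-≤ (indicator≤1 (Q? Fin.zero))
    (ℕ.≤-trans (count-mono (Q? ∘ Fin.suc) (P? ∘ Fin.suc) (λ Qi → [ (λ Pi → Pi) , (λ ()) ] (Q⇒P⊎a Qi)))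
               (ℕ.m≤n+m _ (indicator (P? Fin.zero))))
count-≤-suc {suc n} P? Q? (Fin.suc a) Q⇒P⊎a = ℕ.≤-trans
  (ℕ.+-mono-≤ (indicator-mono (λ Q0 → [ (λ P0 → P0) , (λ ()) ] (Q⇒P⊎a Q0)) (Q? Fin.zero) (P? Fin.zero))
              (count-≤-suc (P? ∘ Fin.suc) (Q? ∘ Fin.suc) a
                           (λ Qi → [ inj₁ , (λ { ≡.refl → inj₂ ≡.refl }) ] (Q⇒P⊎a Qi))))
  (ℕ.≤-reflexive (ℕ.+-suc _ _))

count-mono-<₂ : ∀ {n p q} {P : Pred (Fin n) p} {Q : Pred (Fin n) q} (P? : Decidable P) (Q? : Decidable Q) →
                (∀ {i} → P i → Q i) → ∀ {a b} → Q a → ¬ P a → Q b → ¬ P b → a ≢ b →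
                suc (suc (count P?)) ≤ count Q?
count-mono-<₂ {P = P} P? Q? P⇒Q {a} Qa ¬Pa Qb ¬Pb a≢b =
  ℕ.≤-trans (s≤s (count-mono-< P? P∪a? inj₁ (inj₂ ≡.refl) ¬Pa))
            (count-mono-< P∪a? Q? [ P⇒Q , (λ { ≡.refl → Qa }) ] Qb [ ¬Pb , (λ b≡a → a≢b (≡.sym b≡a)) ])
  where
  P∪a? : Decidable (λ i → P i ⊎ i ≡ a)
  P∪a? i = P? i ⊎-dec (i Fin.≟ a)

count-≡0 : ∀ {n p} {P : Pred (Fin n) p} (P? : Decidable P) → (∀ i → ¬ P i) → count P? ≡ 0
count-≡0 {zero}  P? ¬P = ≡.refl
count-≡0 {suc n} P? ¬P with P? Fin.zero
... | yes P0 = contradiction P0 (¬P Fin.zero)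
... | no _   = count-≡0 (P? ∘ Fin.suc) (¬P ∘ Fin.suc)

Least : ∀ {n p} → Pred (Fin n) p → Fin n → Set p
Least P i = P i × (∀ {j} → P j → i Fin.≤ j)

least-witness : ∀ {n p} {P : Pred (Fin n) p} → Decidable P → ∃ P → ∃ (Least P)
least-witness {suc n} {P = P} P? ∃P with P? Fin.zero
... | yes P0 = Fin.zero , P0 , λ _ → z≤n
... | no ¬P0 = shift-up (least-witness (P? ∘ Fin.suc) (shift-down ∃P))
  where
  shift-down : ∃ P → ∃ (P ∘ Fin.suc)
  shift-down (Fin.zero  , P0) = contradiction P0 ¬P0
  shift-down (Fin.suc i , Pi) = i , Pi
  shift-up : ∃ (Least (P ∘ Fin.suc)) → ∃ (Least P)
  shift-up (i , Pi , i-least) =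
    Fin.suc i , Pi , λ { {Fin.zero} P0 → contradiction P0 ¬P0 ; {Fin.suc j} Pj → s≤s (i-least Pj) }

module FiniteFieldProperties {c ℓ} (F : FiniteField c ℓ) where
  open FiniteField F
  open import Algebra.Properties.Ring ring public
    using (-‿distribˡ-*; -‿distribʳ-*; -‿involutive; -0#≈0#; -1*x≈-x; +-inverseˡ-unique)
  open import Relation.Binary.Reasoning.Setoid setoid

  infix 4 _≈?_
  _≈?_ : ∀ x y → Dec (x ≈ y)
  x ≈? y with enum-sur x | enum-sur y
  ... | i , i↦x | j , j↦y with i Fin.≟ j
  ...   | yes ≡.refl = yes (trans (sym i↦x) j↦y)
  ...   | no  i≢j  = no λ x≈y → i≢j (enum-inj i j (trans i↦x (trans x≈y (sym j↦y))))

  ∃-family? : ∀ d {p} {P : Pred (Fin d → Carrier) p} →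
              (∀ {a a′} → (∀ k → a k ≈ a′ k) → P a → P a′) → Decidable P → Dec (∃ P)
  ∃-family? zero    P-resp P? = map′ (empty ,_) (λ (a , Pa) → P-resp (λ ()) Pa) (P? empty)
    where
    empty : Fin 0 → Carrier
    empty ()
  ∃-family? (suc d) {P = P} P-resp P? =
    map′ to from (Fin.any? λ i → ∃-family? d (P-resp ∘ ∷-congʳ) (P? ∘ (enum i ∷ᵥ_)))
    where
    ∷-congʳ : ∀ {x a a′} → (∀ k → a k ≈ a′ k) → ∀ k → (x ∷ᵥ a) k ≈ (x ∷ᵥ a′) k
    ∷-congʳ a≈a′ Fin.zero    = refl
    ∷-congʳ a≈a′ (Fin.suc k) = a≈a′ k
    to : (∃ λ i → ∃ λ a → P (enum i ∷ᵥ a)) → ∃ P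
    to (i , a , Pa) = enum i ∷ᵥ a , Pa
    from : ∃ P → ∃ λ i → ∃ λ a → P (enum i ∷ᵥ a)
    from (a , Pa) = proj₁ (enum-sur (head a)) , tail a , P-resp a≈ Pa
      where
      a≈ : ∀ k → a k ≈ (enum (proj₁ (enum-sur (head a))) ∷ᵥ tail a) k
      a≈ Fin.zero    = sym (proj₂ (enum-sur (head a)))
      a≈ (Fin.suc k) = refl

  x*y≈0⇒y≈0 : ∀ {x y} → ¬ x ≈ 0# → x * y ≈ 0# → y ≈ 0#
  x*y≈0⇒y≈0 {x} {y} x≉0 xy≈0 with inverse x x≉0
  ... | x⁻¹ , xx⁻¹≈1 = begin
    y               ≈⟨ sym (*-identityˡ y) ⟩
    1# * y          ≈⟨ *-cong (trans (sym xx⁻¹≈1) (*-comm x x⁻¹)) refl ⟩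
    (x⁻¹ * x) * y   ≈⟨ *-assoc x⁻¹ x y ⟩
    x⁻¹ * (x * y)   ≈⟨ *-cong refl xy≈0 ⟩
    x⁻¹ * 0#        ≈⟨ zeroʳ x⁻¹ ⟩
    0#              ∎

  *-≉0 : ∀ {x y} → ¬ x ≈ 0# → ¬ y ≈ 0# → ¬ x * y ≈ 0#
  *-≉0 x≉0 y≉0 xy≈0 = y≉0 (x*y≈0⇒y≈0 x≉0 xy≈0)

  -‿≉0 : ∀ {x} → ¬ x ≈ 0# → ¬ - x ≈ 0#
  -‿≉0 {x} x≉0 -x≈0 = x≉0 (begin
    x       ≈⟨ sym (-‿involutive x) ⟩
    - (- x) ≈⟨ -‿cong -x≈0 ⟩
    - 0#    ≈⟨ -0#≈0# ⟩
    0#      ∎)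

  x+c*y≈0 : ∀ {x y} c → x ≈ 0# → y ≈ 0# → x + c * y ≈ 0#
  x+c*y≈0 {x} {y} c x≈0 y≈0 = begin
    x + c * y   ≈⟨ +-cong x≈0 (*-cong refl y≈0) ⟩
    0# + c * 0# ≈⟨ +-identityˡ (c * 0#) ⟩
    c * 0#      ≈⟨ zeroʳ c ⟩
    0#          ∎

  x-c*y+c*y≈x : ∀ x y c → (x + - c * y) + c * y ≈ x
  x-c*y+c*y≈x x y c = begin
    (x + - c * y) + c * y   ≈⟨ +-assoc x (- c * y) (c * y) ⟩
    x + (- c * y + c * y)   ≈⟨ +-cong refl (+-cong (sym (-‿distribˡ-* c y)) refl) ⟩
    x + (- (c * y) + c * y) ≈⟨ +-cong refl (-‿inverseˡ (c * y)) ⟩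
    x + 0#                  ≈⟨ +-identityʳ x ⟩
    x                       ∎

  x-xy*z≈0 : ∀ x y z → z * y ≈ 1# → x + - (x * y) * z ≈ 0#
  x-xy*z≈0 x y z zy≈1 = begin
    x + - (x * y) * z   ≈⟨ +-cong refl (sym (-‿distribˡ-* (x * y) z)) ⟩
    x + - ((x * y) * z) ≈⟨ +-cong refl (-‿cong (*-assoc x y z)) ⟩
    x + - (x * (y * z)) ≈⟨ +-cong refl (-‿cong (*-cong refl (trans (*-comm y z) zy≈1))) ⟩
    x + - (x * 1#)      ≈⟨ +-cong refl (-‿cong (*-identityʳ x)) ⟩
    x + - x             ≈⟨ -‿inverseʳ x ⟩
    0#                  ∎

  β[αv+s]-α[βv+s′]≈βs-αs′ : ∀ α β v s s′ → β * (α * v + s) + - α * (β * v + s′) ≈ β * s + - α * s′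
  β[αv+s]-α[βv+s′]≈βs-αs′ α β v s s′ = begin
    β * (α * v + s) + - α * (β * v + s′)
      ≈⟨ +-cong (distribˡ β (α * v) s) (distribˡ (- α) (β * v) s′) ⟩
    (β * (α * v) + β * s) + (- α * (β * v) + - α * s′)
      ≈⟨ +-cong (+-comm _ _) (+-cong -αβv≈-βαv refl) ⟩
    (β * s + β * (α * v)) + (- (β * (α * v)) + - α * s′)
      ≈⟨ +-assoc (β * s) _ _ ⟩
    β * s + (β * (α * v) + (- (β * (α * v)) + - α * s′))
      ≈⟨ +-cong refl (sym (+-assoc _ _ _)) ⟩
    β * s + ((β * (α * v) + - (β * (α * v))) + - α * s′)
      ≈⟨ +-cong refl (+-cong (-‿inverseʳ _) refl) ⟩
    β * s + (0# + - α * s′)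
      ≈⟨ +-cong refl (+-identityˡ _) ⟩
    β * s + - α * s′
      ∎
    where
    -αβv≈-βαv : - α * (β * v) ≈ - (β * (α * v))
    -αβv≈-βαv = trans (sym (-‿distribˡ-* α (β * v)))
                      (-‿cong (trans (sym (*-assoc α β v)) (trans (*-cong (*-comm α β) refl) (*-assoc β α v))))

module Subspaces {c ℓ} (F : FiniteField c ℓ) (n t : ℕ) where
  open FiniteField F
  open FiniteFieldProperties F
  open Over F n t

  ≋-sym : ∀ {u v} → u ≋ v → v ≋ u
  ≋-sym u≋v i = sym (u≋v i)

  ⊆-refl : ∀ X → X ⊆ X
  ⊆-refl X v v∈X = v∈X

  ⊆-trans : ∀ X Y Z → X ⊆ Y → Y ⊆ Z → X ⊆ Z
  ⊆-trans X Y Z X⊆Y Y⊆Z v v∈X = Y⊆Z v (X⊆Y v v∈X)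

  ≋0⇒∈ : ∀ X {v} → v ≋ 0v → mem X v
  ≋0⇒∈ X v≋0 = mem-resp X (≋-sym v≋0) (mem-0 X)

  lincomb-cong : ∀ {d} (b : Fin d → Vect) {a a′} → (∀ k → a k ≈ a′ k) → lincomb a b ≋ lincomb a′ b
  lincomb-cong {zero}  b a≈a′ i = refl
  lincomb-cong {suc d} b a≈a′ i = +-cong (*-cong (a≈a′ Fin.zero) refl) (lincomb-cong (tail b) (a≈a′ ∘ Fin.suc) i)

  lincomb-zero : ∀ {d} (b : Fin d → Vect) → lincomb (λ _ → 0#) b ≋ 0v
  lincomb-zero {zero}  b i = refl
  lincomb-zero {suc d} b i = trans (+-cong (zeroˡ (b Fin.zero i)) (lincomb-zero (tail b) i)) (+-identityˡ 0#)

  lincomb∈ : ∀ X {d} {b : Fin d → Vect} → (∀ k → mem X (b k)) → ∀ a → mem X (lincomb a b)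
  lincomb∈ X {zero}  b∈X a = mem-0 X
  lincomb∈ X {suc d} b∈X a = mem-+ X (mem-· X (head a) (b∈X Fin.zero)) (lincomb∈ X (b∈X ∘ Fin.suc) (tail a))

  lincomb∈span : ∀ {d} (b : Fin d → Vect) a → mem (span b) (lincomb a b)
  lincomb∈span b a = a , λ i → refl

  span-least : ∀ X {d} {b : Fin d → Vect} → (∀ k → mem X (b k)) → span b ⊆ X
  span-least X b∈X w (a , w≋ab) = mem-resp X (≋-sym w≋ab) (lincomb∈ X b∈X a)

  span-cons-least : ∀ X {d} {v} {b : Fin d → Vect} → mem X v → span b ⊆ X → span (v ∷ᵥ b) ⊆ X
  span-cons-least X {b = b} v∈X span⊆X w (a , w≋ab) =
    mem-resp X (≋-sym w≋ab) (mem-+ X (mem-· X (head a) v∈X) (span⊆X _ (lincomb∈span b (tail a))))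

  span⊆span-cons : ∀ {d} v (b : Fin d → Vect) → span b ⊆ span (v ∷ᵥ b)
  span⊆span-cons v b w (a , w≋ab) =
    0# ∷ᵥ a , λ i → trans (w≋ab i) (sym (trans (+-cong (zeroˡ (v i)) refl) (+-identityˡ _)))

  head∈span-cons : ∀ {d} v (b : Fin d → Vect) → mem (span (v ∷ᵥ b)) v
  head∈span-cons v b =
    1# ∷ᵥ (λ _ → 0#) , λ i → sym (trans (+-cong (*-identityˡ (v i)) (lincomb-zero b i)) (+-identityʳ (v i)))

  ∈span-singleton : ∀ v → mem (span (λ (_ : Fin 1) → v)) v
  ∈span-singleton v = (λ _ → 1#) , λ i → sym (trans (+-cong (*-identityˡ (v i)) refl) (+-identityʳ (v i)))

  LinIndep-tail : ∀ {d} (b : Fin (suc d) → Vect) → LinIndep b → LinIndep (tail b)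
  LinIndep-tail b b-indep a ab≈0 k =
    b-indep (0# ∷ᵥ a) (λ i → trans (+-cong (zeroˡ _) (ab≈0 i)) (+-identityˡ 0#)) (Fin.suc k)

  LinIndep-head∉span-tail : ∀ {d} (b : Fin (suc d) → Vect) → LinIndep b → ¬ mem (span (tail b)) (head b)
  LinIndep-head∉span-tail b b-indep (a , b₀≋ab) =
    -‿≉0 (λ 1≈0 → 0≉1 (sym 1≈0)) (b-indep (- 1# ∷ᵥ a) combination≈0 Fin.zero)
    where
    combination≈0 : lincomb (- 1# ∷ᵥ a) b ≋ 0v
    combination≈0 i = trans (+-cong (-1*x≈-x (head b i)) (sym (b₀≋ab i))) (-‿inverseˡ (head b i))

  LinIndep-cons : ∀ {d} {v} {b : Fin d → Vect} → LinIndep b → ¬ mem (span b) v → LinIndep (v ∷ᵥ b)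
  LinIndep-cons {v = v} {b} b-indep v∉span a a[v∷b]≈0 with head a ≈? 0#
  ... | yes a₀≈0 = λ { Fin.zero → a₀≈0 ; (Fin.suc k) → b-indep (tail a) ab≈0 k }
    where
    ab≈0 : lincomb (tail a) b ≋ 0v
    ab≈0 i = trans (sym (+-identityˡ _))
                   (trans (+-cong (sym (trans (*-cong a₀≈0 refl) (zeroˡ (v i)))) refl) (a[v∷b]≈0 i))
  ... | no a₀≉0 with inverse (head a) a₀≉0
  ...   | a₀⁻¹ , a₀a₀⁻¹≈1 =
    contradiction (mem-resp (span b) v≋ (mem-· (span b) (- a₀⁻¹) (lincomb∈span b (tail a)))) v∉span
    where
    open import Relation.Binary.Reasoning.Setoid setoid
    v≋ : ((- a₀⁻¹) ·v lincomb (tail a) b) ≋ v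
    v≋ i = begin
      - a₀⁻¹ * s               ≈⟨ sym (-‿distribˡ-* a₀⁻¹ s) ⟩
      - (a₀⁻¹ * s)             ≈⟨ -‿distribʳ-* a₀⁻¹ s ⟩
      a₀⁻¹ * - s               ≈⟨ *-cong refl (sym a₀v≈-s) ⟩
      a₀⁻¹ * (head a * v i)    ≈⟨ sym (*-assoc a₀⁻¹ (head a) (v i)) ⟩
      (a₀⁻¹ * head a) * v i    ≈⟨ *-cong (trans (*-comm a₀⁻¹ (head a)) a₀a₀⁻¹≈1) refl ⟩
      1# * v i                 ≈⟨ *-identityˡ (v i) ⟩
      v i                      ∎
      where
      s : Carrier
      s = lincomb (tail a) b i
      a₀v≈-s : head a * v i ≈ - s
      a₀v≈-s = +-inverseˡ-unique (head a * v i) s (a[v∷b]≈0 i)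

  Pivot : Subspace → Fin n → Set (c ⊔ ℓ)
  Pivot X j = ∃[ v ] (mem X v × LastNonzero v j)

  NewPivot : Subspace → Subspace → Fin n → Set (c ⊔ ℓ)
  NewPivot X Y j = Pivot Y j × ¬ Pivot X j

  Pivot-mono : ∀ X Y → X ⊆ Y → ∀ {j} → Pivot X j → Pivot Y j
  Pivot-mono X Y X⊆Y (v , v∈X , v-last) = v , X⊆Y v v∈X , v-last

  ∈fA⇒Pivot : ∀ X {j} → j ∈fA X → Pivot X j
  ∈fA⇒Pivot X (V , _ , V⊆X , v , _ , (_ , span⊆V) , v-last) =
    v , V⊆X v (span⊆V v (∈span-singleton v)) , v-last

  Pivot⇒∈fA : ∀ X {j} → Pivot X j → j ∈fA X
  Pivot⇒∈fA X {j} (v , v∈X , v-last) =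
    V , ((λ _ → v) , v-indep , (⊆-refl V , ⊆-refl V)) , span-least X (λ _ → v∈X) ,
    (v , (λ v≋0 → proj₁ v-last (v≋0 j)) , (⊆-refl V , ⊆-refl V) , v-last)
    where
    V : Subspace
    V = span (λ (_ : Fin 1) → v)
    v-indep : LinIndep (λ (_ : Fin 1) → v)
    v-indep a av≈0 Fin.zero =
      x*y≈0⇒y≈0 (proj₁ v-last) (trans (*-comm (v j) _) (trans (sym (+-identityʳ _)) (av≈0 j)))

  BLabel⇒NewPivot : ∀ X Y {j} → BLabel X Y j → NewPivot X Y j
  BLabel⇒NewPivot X Y (j∈Y , j∉X) = ∈fA⇒Pivot Y j∈Y , j∉X ∘ Pivot⇒∈fA X

  NewPivot⇒BLabel : ∀ X Y {j} → NewPivot X Y j → BLabel X Y j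
  NewPivot⇒BLabel X Y (Y-pivot , ¬X-pivot) = Pivot⇒∈fA Y Y-pivot , ¬X-pivot ∘ ∈fA⇒Pivot X

  LastNonzero-resp : ∀ {u v j} → u ≋ v → LastNonzero u j → LastNonzero v j
  LastNonzero-resp u≋v (uj≉0 , u-above) =
    (λ vj≈0 → uj≉0 (trans (u≋v _) vj≈0)) , λ k j<k → trans (sym (u≋v k)) (u-above k j<k)

  lastNonzero? : ∀ v j → Dec (LastNonzero v j)
  lastNonzero? v j = ¬? (v j ≈? 0#) ×-dec Fin.all? (λ k → (j Fin.<? k) →-dec (v k ≈? 0#))

  pivot?-span : ∀ {d} (b : Fin d → Vect) → Decidable (Pivot (span b))
  pivot?-span {d} b j with ∃-family? d (LastNonzero-resp ∘ lincomb-cong b) (λ a → lastNonzero? (lincomb a b) j)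
  ... | yes (a , ab-last) = yes (lincomb a b , lincomb∈span b a , ab-last)
  ... | no ¬∃             = no λ (v , (a , v≋ab) , v-last) → ¬∃ (a , LastNonzero-resp v≋ab v-last)

  pivot? : ∀ X {d} → HasDim X d → Decidable (Pivot X)
  pivot? X (b , _ , X⊆span , span⊆X) j with pivot?-span b j
  ... | yes span-pivot = yes (Pivot-mono (span b) X span⊆X span-pivot)
  ... | no ¬span-pivot = no (¬span-pivot ∘ Pivot-mono X (span b) X⊆span)

  new-pivot? : ∀ X Y → Decidable (Pivot X) → Decidable (Pivot Y) →
               ∃ (NewPivot X Y) ⊎ (∀ {j} → Pivot Y j → Pivot X j)
  new-pivot? X Y X? Y? with Fin.any? (λ j → Y? j ×-dec ¬? (X? j))
  ... | yes ∃new = inj₁ ∃new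
  ... | no ¬∃new = inj₂ λ {j} Y-pivot → decidable-stable (X? j) (λ ¬X-pivot → ¬∃new (j , Y-pivot , ¬X-pivot))

  Below : ℕ → Vect → Set ℓ
  Below m w = ∀ j → m ≤ toℕ j → w j ≈ 0#

  Below-zero : ∀ {w} → Below 0 w → w ≋ 0v
  Below-zero w-below j = w-below j z≤n

  Below-suc : ∀ {m w} → Below (suc m) w → Below m w ⊎ ∃[ j ] (toℕ j ≡ m × LastNonzero w j)
  Below-suc {m} {w} w-below with m ℕ.<? n
  ... | no m≮n = inj₁ λ j m≤j → contradiction (ℕ.≤-<-trans m≤j (Fin.toℕ<n j)) m≮n
  ... | yes m<n with w (fromℕ< m<n) ≈? 0#
  ...   | no wₘ≉0 = inj₂ (fromℕ< m<n , Fin.toℕ-fromℕ< m<n ,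
                          wₘ≉0 , λ k m<k → w-below k (≡.subst (_< toℕ k) (Fin.toℕ-fromℕ< m<n) m<k))
  ...   | yes wₘ≈0 = inj₁ below-m
    where
    below-m : Below m w
    below-m j m≤j with m ℕ.≟ toℕ j
    ... | yes m≡j = ≡.subst (λ k → w k ≈ 0#) (Fin.toℕ-injective (≡.trans (Fin.toℕ-fromℕ< m<n) m≡j)) wₘ≈0
    ... | no  m≢j = w-below j (ℕ.≤∧≢⇒< m≤j m≢j)

  reduce-by-pivot : ∀ X Y → X ⊆ Y → ∀ {w j} → mem Y w → LastNonzero w j → Pivot X j →
                    ∃[ w′ ] (mem Y w′ × Below (toℕ j) w′ × (mem X w′ → mem X w))
  reduce-by-pivot X Y X⊆Y {w} {j} w∈Y (_ , w-above) (u , u∈X , uj≉0 , u-above) with inverse (u j) uj≉0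
  ... | y , ujy≈1 = w +v ((- r) ·v u) , mem-+ Y w∈Y (mem-· Y (- r) (X⊆Y u u∈X)) , below , w∈X
    where
    r : Carrier
    r = w j * y
    below : Below (toℕ j) (w +v ((- r) ·v u))
    below k j≤k with toℕ j ℕ.≟ toℕ k
    ... | yes j≡k = ≡.subst (λ k → w k + - r * u k ≈ 0#) (Fin.toℕ-injective j≡k)
                            (x-xy*z≈0 (w j) y (u j) ujy≈1)
    ... | no  j≢k = x+c*y≈0 (- r) (w-above k (ℕ.≤∧≢⇒< j≤k j≢k)) (u-above k (ℕ.≤∧≢⇒< j≤k j≢k))
    w∈X : mem X (w +v ((- r) ·v u)) → mem X w
    w∈X w-cu∈X = mem-resp X (λ i → x-c*y+c*y≈x (w i) (u i) r) (mem-+ X w-cu∈X (mem-· X r u∈X))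

  ∈-by-pivots-below : ∀ X Y → X ⊆ Y → ∀ m → (∀ {j} → toℕ j < m → Pivot Y j → Pivot X j) →
                      ∀ {w} → mem Y w → Below m w → mem X w
  ∈-by-pivots-below X Y X⊆Y zero    pivots-below w∈Y w-below = ≋0⇒∈ X (Below-zero w-below)
  ∈-by-pivots-below X Y X⊆Y (suc m) pivots-below {w} w∈Y w-below with Below-suc w-below
  ... | inj₁ w-below-m = ∈-by-pivots-below X Y X⊆Y m (pivots-below ∘ ℕ.m<n⇒m<1+n) w∈Y w-below-m
  ... | inj₂ (j , j≡m , w-last)
    with reduce-by-pivot X Y X⊆Y w∈Y w-last (pivots-below (s≤s (ℕ.≤-reflexive j≡m)) (w , w∈Y , w-last))
  ...   | w′ , w′∈Y , w′-below , w′∈X⇒w∈X =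
    w′∈X⇒w∈X (∈-by-pivots-below X Y X⊆Y m (pivots-below ∘ ℕ.m<n⇒m<1+n) w′∈Y
                                  (≡.subst (λ k → Below k w′) j≡m w′-below))

  pivots⊆⇒⊇ : ∀ X Y → X ⊆ Y → (∀ {j} → Pivot Y j → Pivot X j) → Y ⊆ X
  pivots⊆⇒⊇ X Y X⊆Y Y-pivots⊆ w w∈Y =
    ∈-by-pivots-below X Y X⊆Y n (λ _ → Y-pivots⊆) w∈Y (λ j n≤j → contradiction (Fin.toℕ<n j) (ℕ.≤⇒≯ n≤j))

  ∈span-tail : ∀ {d} (b : Fin (suc d) → Vect) {u} a → u ≋ lincomb a b → head a ≈ 0# → mem (span (tail b)) u
  ∈span-tail b {u} a u≋ab a₀≈0 = mem-resp (span (tail b)) u≋ab′ (lincomb∈span (tail b) (tail a))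
    where
    u≋ab′ : lincomb (tail a) (tail b) ≋ u
    u≋ab′ i = sym (trans (u≋ab i) (trans (+-cong (trans (*-cong a₀≈0 refl) (zeroˡ _)) refl) (+-identityˡ _)))

  LastNonzero-+ : ∀ {u w j} β {α} → (∀ k → j Fin.≤ k → u k ≈ 0#) → LastNonzero w j → ¬ α ≈ 0# →
                  LastNonzero ((β ·v u) +v (α ·v w)) j
  LastNonzero-+ {u} {w} {j} β {α} u-vanishes (wj≉0 , w-above) α≉0 = value≉0 , above
    where
    value≉0 : ¬ β * u j + α * w j ≈ 0#
    value≉0 value≈0 = *-≉0 α≉0 wj≉0 (trans (sym (+-identityˡ _))
      (trans (+-cong (sym (trans (*-cong refl (u-vanishes j Fin.≤-refl)) (zeroʳ β))) refl) value≈0))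
    above : ∀ k → j Fin.< k → β * u k + α * w k ≈ 0#
    above k j<k = trans (+-cong (trans (*-cong refl (u-vanishes k (ℕ.<⇒≤ j<k))) (zeroʳ β)) refl)
                        (x+c*y≈0 α refl (w-above k j<k))

  -- If u = α b₀ + s and w = β b₀ + s′ (with s, s′ ∈ span (tail b)) have the new pivots j < j′,
  -- then β u - α w = β s - α s′ lies in span (tail b) and still has pivot j′.
  span-cons-two-new-pivots-absurd : ∀ {d} (b : Fin (suc d) → Vect) {j j′} → j Fin.< j′ →
                                    NewPivot (span (tail b)) (span b) j → ¬ NewPivot (span (tail b)) (span b) j′
  span-cons-two-new-pivots-absurd b {j′ = j′} j<j′
    ((u , (A , u≋Ab) , u-last) , j∉X′) ((w , (B , w≋Bb) , w-last) , j′∉X′)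
    with head A ≈? 0# | head B ≈? 0#
  ... | yes α≈0 | _       = j∉X′ (u , ∈span-tail b A u≋Ab α≈0 , u-last)
  ... | no _    | yes β≈0 = j′∉X′ (w , ∈span-tail b B w≋Bb β≈0 , w-last)
  ... | no α≉0  | no _    = j′∉X′ (_ , difference∈X′ , LastNonzero-resp difference≋ difference-last)
    where
    X′ : Subspace
    X′ = span (tail b)
    α β : Carrier
    α = head A
    β = head B
    s s′ : Vect
    s = lincomb (tail A) (tail b)
    s′ = lincomb (tail B) (tail b)
    difference∈X′ : mem X′ ((β ·v s) +v ((- α) ·v s′))
    difference∈X′ = mem-+ X′ (mem-· X′ β (lincomb∈span _ _)) (mem-· X′ (- α) (lincomb∈span _ _))
    difference≋ : ((β ·v u) +v ((- α) ·v w)) ≋ ((β ·v s) +v ((- α) ·v s′))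
    difference≋ i = trans (+-cong (*-cong refl (u≋Ab i)) (*-cong refl (w≋Bb i)))
                          (β[αv+s]-α[βv+s′]≈βs-αs′ α β (head b i) (s i) (s′ i))
    difference-last : LastNonzero ((β ·v u) +v ((- α) ·v w)) j′
    difference-last = LastNonzero-+ β (λ k j′≤k → proj₂ u-last k (ℕ.<-≤-trans j<j′ j′≤k)) w-last (-‿≉0 α≉0)

  span-cons-new-pivot-unique : ∀ {d} (b : Fin (suc d) → Vect) {j j′} →
                               NewPivot (span (tail b)) (span b) j → NewPivot (span (tail b)) (span b) j′ → j ≡ j′
  span-cons-new-pivot-unique b {j} {j′} j-new j′-new with Fin.<-cmp j j′
  ... | tri< j<j′ _ _ = contradiction j′-new (span-cons-two-new-pivots-absurd b j<j′ j-new)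
  ... | tri≈ _ j≡j′ _ = j≡j′
  ... | tri> _ _ j′<j = contradiction j-new (span-cons-two-new-pivots-absurd b j′<j j′-new)

  #pivots-span : ∀ {d} (b : Fin d → Vect) → LinIndep b → count (pivot?-span b) ≡ d
  #pivots-span {zero}  b _ = count-≡0 (pivot?-span b) λ j (v , (_ , v≋0) , vj≉0 , _) → vj≉0 (v≋0 j)
  #pivots-span {suc d} b b-indep with new-pivot? (span (tail b)) (span b) (pivot?-span (tail b)) (pivot?-span b)
  ... | inj₂ pivots⊆ = contradiction (pivots⊆⇒⊇ (span (tail b)) (span b) (span⊆span-cons (head b) (tail b)) pivots⊆
                                                  (head b) (head∈span-cons (head b) (tail b)))
                                     (LinIndep-head∉span-tail b b-indep)
  ... | inj₁ (a , a-new) = ≡.trans (ℕ.≤-antisym at-most-one-more at-least-one-more)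
                                   (≡.cong suc (#pivots-span (tail b) (LinIndep-tail b b-indep)))
    where
    at-least-one-more : suc (count (pivot?-span (tail b))) ≤ count (pivot?-span b)
    at-least-one-more = count-mono-< (pivot?-span (tail b)) (pivot?-span b)
                          (Pivot-mono (span (tail b)) (span b) (span⊆span-cons (head b) (tail b)))
                          (proj₁ a-new) (proj₂ a-new)
    only-a-new : ∀ {j} → Pivot (span b) j → Pivot (span (tail b)) j ⊎ j ≡ a
    only-a-new {j} j-pivot with pivot?-span (tail b) j
    ... | yes j-pivot′ = inj₁ j-pivot′
    ... | no ¬j-pivot′ = inj₂ (span-cons-new-pivot-unique b (j-pivot , ¬j-pivot′) a-new)
    at-most-one-more : count (pivot?-span b) ≤ suc (count (pivot?-span (tail b)))
    at-most-one-more = count-≤-suc (pivot?-span (tail b)) (pivot?-span b) a only-a-new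

  #pivots : ∀ X {d} (hX : HasDim X d) → count (pivot? X hX) ≡ d
  #pivots X hX@(b , b-indep , X⊆span , span⊆X) =
    ≡.trans (ℕ.≤-antisym (count-mono (pivot? X hX) (pivot?-span b) (Pivot-mono X (span b) X⊆span))
                         (count-mono (pivot?-span b) (pivot? X hX) (Pivot-mono (span b) X span⊆X)))
            (#pivots-span b b-indep)

  module _ X Y {d e} (hX : HasDim X d) (hY : HasDim Y e) where

    dim-mono : X ⊆ Y → d ≤ e
    dim-mono X⊆Y = ≡.subst₂ _≤_ (#pivots X hX) (#pivots Y hY)
                     (count-mono (pivot? X hX) (pivot? Y hY) (Pivot-mono X Y X⊆Y))

    dim-mono-< : X ⊆ Y → ∀ {a} → NewPivot X Y a → d < e
    dim-mono-< X⊆Y (a∈Y , a∉X) = ≡.subst₂ _<_ (#pivots X hX) (#pivots Y hY)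
                                   (count-mono-< (pivot? X hX) (pivot? Y hY) (Pivot-mono X Y X⊆Y) a∈Y a∉X)

    dim-mono-<₂ : X ⊆ Y → ∀ {a a′} → NewPivot X Y a → NewPivot X Y a′ → a ≢ a′ → suc (suc d) ≤ e
    dim-mono-<₂ X⊆Y (a∈Y , a∉X) (a′∈Y , a′∉X) a≢a′ =
      ≡.subst₂ (λ d e → suc (suc d) ≤ e) (#pivots X hX) (#pivots Y hY)
        (count-mono-<₂ (pivot? X hX) (pivot? Y hY) (Pivot-mono X Y X⊆Y) a∈Y a∉X a′∈Y a′∉X a≢a′)

    dim-≤⇒⊇ : X ⊆ Y → e ≤ d → Y ⊆ X
    dim-≤⇒⊇ X⊆Y e≤d with new-pivot? X Y (pivot? X hX) (pivot? Y hY)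
    ... | inj₁ (a , a-new) = contradiction (dim-mono-< X⊆Y a-new) (ℕ.≤⇒≯ e≤d)
    ... | inj₂ pivots⊆     = pivots⊆⇒⊇ X Y X⊆Y pivots⊆

    least-new-pivot : d < e → ∃ (Least (NewPivot X Y))
    least-new-pivot d<e with new-pivot? X Y (pivot? X hX) (pivot? Y hY)
    ... | inj₁ ∃new   = least-witness (λ j → pivot? Y hY j ×-dec ¬? (pivot? X hX j)) ∃new
    ... | inj₂ pivots⊆ = contradiction (≡.subst₂ _≤_ (#pivots Y hY) (#pivots X hX)
                                          (count-mono (pivot? Y hY) (pivot? X hX) pivots⊆))
                                       (ℕ.<⇒≱ d<e)

  adjoin : ∀ X {d} → HasDim X d → Vect → Subspace
  adjoin X (b , _) v = span (v ∷ᵥ b)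

  ∈-adjoin : ∀ X {d} (hX : HasDim X d) v → mem (adjoin X hX v) v
  ∈-adjoin X (b , _) v = head∈span-cons v b

  ⊆-adjoin : ∀ X {d} (hX : HasDim X d) v → X ⊆ adjoin X hX v
  ⊆-adjoin X (b , _ , X⊆span , _) v = ⊆-trans X (span b) (span (v ∷ᵥ b)) X⊆span (span⊆span-cons v b)

  adjoin-least : ∀ X {d} (hX : HasDim X d) {v} W → X ⊆ W → mem W v → adjoin X hX v ⊆ W
  adjoin-least X (b , _ , _ , span⊆X) W X⊆W v∈W = span-cons-least W v∈W (⊆-trans (span b) X W span⊆X X⊆W)

  adjoin-HasDim : ∀ X {d} (hX : HasDim X d) {v a} → LastNonzero v a → ¬ Pivot X a →
                  HasDim (adjoin X hX v) (suc d)
  adjoin-HasDim X (b , b-indep , _ , span⊆X) {v} v-last a∉X =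
    v ∷ᵥ b , LinIndep-cons b-indep (λ v∈span → a∉X (v , span⊆X v v∈span , v-last)) ,
    ⊆-refl (span (v ∷ᵥ b)) , ⊆-refl (span (v ∷ᵥ b))

  -- Reducing v by a vector of W with the same pivot a leaves a vector of Y below a, which lies in X
  -- because a is the least new pivot.
  adjoin-least-new-pivot : ∀ X Y {d} (hX : HasDim X d) {v a} → X ⊆ Y → mem Y v → LastNonzero v a →
                           (∀ {j} → NewPivot X Y j → a Fin.≤ j) →
                           ∀ W → X ⊆ W → W ⊆ Y → Pivot W a → adjoin X hX v ⊆ W
  adjoin-least-new-pivot X Y hX {a = a} X⊆Y v∈Y v-last a-least W X⊆W W⊆Y a∈W
    with reduce-by-pivot W Y W⊆Y v∈Y v-last a∈W
  ... | v′ , v′∈Y , v′-below , v′∈W⇒v∈W =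
    adjoin-least X hX W X⊆W (v′∈W⇒v∈W (X⊆W v′ (∈-by-pivots-below X Y X⊆Y (toℕ a) pivots-below v′∈Y v′-below)))
    where
    pivots-below : ∀ {j} → toℕ j < toℕ a → Pivot Y j → Pivot X j
    pivots-below {j} j<a j∈Y = decidable-stable (pivot? X hX j) λ j∉X → ℕ.<⇒≱ j<a (a-least (j∈Y , j∉X))

-- All components of a tuple share one dimension, compared through the component i₀ (this is
-- where t ≥ 1 is used).
module SegrePower {c ℓ} (F : FiniteField c ℓ) (n t : ℕ) (i₀ : Fin t) where
  open Over F n t
  open Subspaces F n t

  ≤S-refl : ∀ x → x ≤S x
  ≤S-refl x i = ⊆-refl (comp x i)

  ≤S-trans : ∀ x y z → x ≤S y → y ≤S z → x ≤S z
  ≤S-trans x y z x≤y y≤z i = ⊆-trans (comp x i) (comp y i) (comp z i) (x≤y i) (y≤z i)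

  dim-monoS : ∀ x y → x ≤S y → dim x ≤ dim y
  dim-monoS x y x≤y = dim-mono (comp x i₀) (comp y i₀) (dims x i₀) (dims y i₀) (x≤y i₀)

  dim-≤⇒≥S : ∀ x y → x ≤S y → dim y ≤ dim x → y ≤S x
  dim-≤⇒≥S x y x≤y e≤d i = dim-≤⇒⊇ (comp x i) (comp y i) (dims x i) (dims y i) (x≤y i) e≤d

  Chain⇒≤S : ∀ {x y} → Chain x y → x ≤S y
  Chain⇒≤S (stop (x≤y , _))         = x≤y
  Chain⇒≤S {x} {y} (step z x⋖z z→y) = ≤S-trans x z y (proj₁ (proj₁ x⋖z)) (Chain⇒≤S z→y)

  ⋖S-intro : ∀ x z → x ≤S z → dim z ≡ suc (dim x) → x ⋖S z
  ⋖S-intro x z x≤z dim-z = (x≤z , z≰x) , λ (w , (x≤w , w≰x) , (w≤z , z≰w)) → intermediate w x≤w w≰x w≤z z≰w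
    where
    z≰x : ¬ z ≤S x
    z≰x z≤x = ℕ.<⇒≱ (ℕ.≤-reflexive (≡.sym dim-z)) (dim-monoS z x z≤x)
    intermediate : ∀ w → x ≤S w → ¬ w ≤S x → w ≤S z → ¬ z ≤S w → ⊥
    intermediate w x≤w w≰x w≤z z≰w with dim w ℕ.≤? dim x
    ... | yes dw≤dx = w≰x (dim-≤⇒≥S x w x≤w dw≤dx)
    ... | no  dw≰dx = z≰w (dim-≤⇒≥S w z w≤z (≡.subst (_≤ dim w) (≡.sym dim-z) (ℕ.≰⇒> dw≰dx)))

  record GreedyStep (x y : Seg) : Set (Level.suc (c ⊔ ℓ)) where
    field
      cover         : Seg
      label         : Label
      x⋖cover       : x ⋖S cover
      dim-cover     : dim cover ≡ suc (dim x)
      cover≤y       : cover ≤S y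
      labelled      : SegLabel x cover label
      label-least   : ∀ i {j} → NewPivot (comp x i) (comp y i) j → label i Fin.≤ j
      cover-minimal : ∀ i W → comp x i ⊆ W → W ⊆ comp y i → Pivot W (label i) → comp cover i ⊆ W

    label-new : ∀ i → NewPivot (comp x i) (comp cover i) (label i)
    label-new i = BLabel⇒NewPivot (comp x i) (comp cover i) (labelled i)

    label-new-in-y : ∀ i → NewPivot (comp x i) (comp y i) (label i)
    label-new-in-y i = Pivot-mono (comp cover i) (comp y i) (cover≤y i) (proj₁ (label-new i)) , proj₂ (label-new i)

  opaque
    greedy-step : ∀ x y → x ≤S y → dim x < dim y → GreedyStep x y
    greedy-step x y x≤y dx<dy = record
      { cover         = z
      ; label         = a
      ; x⋖cover       = ⋖S-intro x z x≤z ≡.refl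
      ; dim-cover     = ≡.refl
      ; cover≤y       = λ i → adjoin-least (X i) (dims x i) (Y i) (x≤y i) (v∈Y i)
      ; labelled      = λ i → NewPivot⇒BLabel (X i) (Z i)
                                  ((v i , ∈-adjoin (X i) (dims x i) (v i) , v-last i) , proj₂ (a-new i))
      ; label-least   = a-least
      ; cover-minimal = λ i → adjoin-least-new-pivot (X i) (Y i) (dims x i) (x≤y i) (v∈Y i) (v-last i) (a-least i)
      }
      where
      X Y : Fin t → Subspace
      X = comp x
      Y = comp y
      new : ∀ i → ∃ (Least (NewPivot (X i) (Y i)))
      new i = least-new-pivot (X i) (Y i) (dims x i) (dims y i) dx<dy
      a : Label
      a i = proj₁ (new i)
      a-new : ∀ i → NewPivot (X i) (Y i) (a i)
      a-new i = proj₁ (proj₂ (new i))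
      a-least : ∀ i {j} → NewPivot (X i) (Y i) j → a i Fin.≤ j
      a-least i = proj₂ (proj₂ (new i))
      v : Fin t → Vect
      v i = proj₁ (proj₁ (a-new i))
      v∈Y : ∀ i → mem (Y i) (v i)
      v∈Y i = proj₁ (proj₂ (proj₁ (a-new i)))
      v-last : ∀ i → LastNonzero (v i) (a i)
      v-last i = proj₂ (proj₂ (proj₁ (a-new i)))
      Z : Fin t → Subspace
      Z i = adjoin (X i) (dims x i) (v i)
      z : Seg
      z = record
        { comp = Z
        ; dim  = suc (dim x)
        ; dims = λ i → adjoin-HasDim (X i) (dims x i) (v-last i) (proj₂ (a-new i))
        }
      x≤z : x ≤S z
      x≤z i = ⊆-adjoin (X i) (dims x i) (v i)

  ⋖S⇒dim-suc : ∀ x w → x ⋖S w → dim w ≡ suc (dim x)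
  ⋖S⇒dim-suc x w ((x≤w , w≰x) , nothing-between) with ℕ.<-cmp (dim w) (suc (dim x))
  ... | tri< dw<1+dx _ _ = contradiction (dim-≤⇒≥S x w x≤w (ℕ.≤-pred dw<1+dx)) w≰x
  ... | tri≈ _ dw≡1+dx _ = dw≡1+dx
  ... | tri> _ _ 1+dx<dw = contradiction (z , proj₁ x⋖cover , cover≤y , w≰z) nothing-between
    where
    open GreedyStep (greedy-step x w x≤w (ℕ.<-trans (ℕ.n<1+n (dim x)) 1+dx<dw)) renaming (cover to z)
    w≰z : ¬ w ≤S z
    w≰z w≤z = ℕ.<⇒≱ 1+dx<dw (≡.subst (dim w ≤_) dim-cover (dim-monoS w z w≤z))

  ⋖S-new-pivot-unique : ∀ x w {a} → x ⋖S w → SegLabel x w a →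
                        ∀ i {j} → NewPivot (comp x i) (comp w i) j → j ≡ a i
  ⋖S-new-pivot-unique x w {a} x⋖w labelled i {j} j-new with j Fin.≟ a i
  ... | yes j≡aᵢ = j≡aᵢ
  ... | no  j≢aᵢ = contradiction (≡.subst (suc (suc (dim x)) ≤_) (⋖S⇒dim-suc x w x⋖w)
                                   (dim-mono-<₂ (comp x i) (comp w i) (dims x i) (dims w i) (proj₁ (proj₁ x⋖w) i)
                                     j-new (BLabel⇒NewPivot (comp x i) (comp w i) (labelled i)) j≢aᵢ))
                                 (ℕ.n≮n _)

  new-pivot∈labels : ∀ {x y} (ch : Chain x y) {ls} → LabelSeq SegLabel ch ls →
                     ∀ i {j} → NewPivot (comp x i) (comp y i) j → Any (λ a → a i ≡ j) ls
  new-pivot∈labels {x} {y} (stop (_ , y≤x)) ls-stop i (j∈Y , j∉X) =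
    contradiction (Pivot-mono (comp y i) (comp x i) (y≤x i) j∈Y) j∉X
  new-pivot∈labels {x} (step w x⋖w w→y) (ls-step labelled labels) i {j} (j∈Y , j∉X)
    with pivot? (comp w i) (dims w i) j
  ... | yes j∈W = here (≡.sym (⋖S-new-pivot-unique x w x⋖w labelled i (j∈W , j∉X)))
  ... | no  j∉W = there (new-pivot∈labels w→y labels i (j∈Y , j∉W))

  Increasing-tail : ∀ {a} ls → Increasing (a ∷ ls) → Increasing ls
  Increasing-tail []       _               = tt
  Increasing-tail (b ∷ ls) (_ , b∷ls-incr) = b∷ls-incr

  Increasing-head≤ : ∀ {a ls} i {j} → Increasing (a ∷ ls) → Any (λ b → b i ≡ j) (a ∷ ls) → a i Fin.≤ j
  Increasing-head≤ i _ (here aᵢ≡j) = Fin.≤-reflexive aᵢ≡j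
  Increasing-head≤ {ls = b ∷ ls} i (a<b , b∷ls-incr) (there j∈ls) =
    Fin.≤-trans (proj₁ a<b i) (Increasing-head≤ i b∷ls-incr j∈ls)

  module _ {x y} (s : GreedyStep x y) where
    open GreedyStep s

    label-<L-next : (s′ : GreedyStep cover y) → label <L GreedyStep.label s′
    label-<L-next s′ = (λ i → label-least i (new-over-x i)) , label≉
      where
      module S′ = GreedyStep s′
      new-over-x : ∀ i → NewPivot (comp x i) (comp y i) (S′.label i)
      new-over-x i = proj₁ (S′.label-new-in-y i) ,
                     proj₂ (S′.label-new-in-y i) ∘ Pivot-mono (comp x i) (comp cover i) (proj₁ (proj₁ x⋖cover) i)
      label≉ : ¬ label ≗L S′.label
      label≉ label≗ =
        proj₂ (S′.label-new i₀) (≡.subst (Pivot (comp cover i₀)) (label≗ i₀) (proj₁ (label-new i₀)))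

    label-≤L : ∀ x′ w {a′} → x ≤S x′ → w ≤S y → SegLabel x′ w a′ → label ≤L a′
    label-≤L x′ w {a′} x≤x′ w≤y labelled′ i = label-least i
      (Pivot-mono (comp w i) (comp y i) (w≤y i) (proj₁ a′-new) ,
       proj₂ a′-new ∘ Pivot-mono (comp x i) (comp x′ i) (x≤x′ i))
      where
      a′-new : NewPivot (comp x′ i) (comp w i) (a′ i)
      a′-new = BLabel⇒NewPivot (comp x′ i) (comp w i) (labelled′ i)

    increasing-≥L : ∀ {x′ a′ ls} → x′ ≤S x → (ch : Chain x′ y) → LabelSeq SegLabel ch (a′ ∷ ls) →
                    Increasing (a′ ∷ ls) → a′ ≤L label
    increasing-≥L {x′} x′≤x ch labelled′ incr i = Increasing-head≤ i incr (new-pivot∈labels ch labelled′ i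
      (proj₁ (label-new-in-y i) , proj₂ (label-new-in-y i) ∘ Pivot-mono (comp x′ i) (comp x i) (x′≤x i)))

    cover-≐S : ∀ x′ w {a′} → x ≐S x′ → x′ ⋖S w → w ≤S y → SegLabel x′ w a′ → label ≗L a′ → cover ≐S w
    cover-≐S x′ w (x≤x′ , x′≤x) x′⋖w w≤y labelled′ label≗a′ = cover≤w , dim-≤⇒≥S cover w cover≤w dim-w≤
      where
      cover≤w : cover ≤S w
      cover≤w i = cover-minimal i (comp w i)
        (⊆-trans (comp x i) (comp x′ i) (comp w i) (x≤x′ i) (proj₁ (proj₁ x′⋖w) i)) (w≤y i)
        (≡.subst (Pivot (comp w i)) (≡.sym (label≗a′ i)) (proj₁ (BLabel⇒NewPivot (comp x′ i) (comp w i) (labelled′ i))))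
      dim-w≤ : dim w ≤ dim cover
      dim-w≤ = ≡.subst₂ _≤_ (≡.sym (⋖S⇒dim-suc x′ w x′⋖w)) (≡.sym dim-cover) (s≤s (dim-monoS x′ x x′≤x))

  module GreedyChain (y : Seg) where

    gap⇒< : ∀ k x → dim y ≡ suc k ℕ.+ dim x → dim x < dim y
    gap⇒< k x gap = ≡.subst (dim x <_) (≡.sym gap) (s≤s (ℕ.m≤n+m (dim x) k))

    module Step k x (x≤y : x ≤S y) (gap : dim y ≡ suc k ℕ.+ dim x) where

      greedy : GreedyStep x y
      greedy = greedy-step x y x≤y (gap⇒< k x gap)

      open GreedyStep greedy public

      cover-gap : dim y ≡ k ℕ.+ dim cover
      cover-gap = ≡.trans gap (≡.trans (≡.sym (ℕ.+-suc k (dim x))) (≡.cong (k ℕ.+_) (≡.sym dim-cover)))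

    chain : ∀ k x → x ≤S y → dim y ≡ k ℕ.+ dim x → Chain x y
    chain zero    x x≤y gap = stop (x≤y , dim-≤⇒≥S x y x≤y (ℕ.≤-reflexive gap))
    chain (suc k) x x≤y gap = step cover x⋖cover (chain k cover cover≤y cover-gap)
      where open Step k x x≤y gap

    chain-labels : ∀ k x → x ≤S y → dim y ≡ k ℕ.+ dim x → List Label
    chain-labels zero    x x≤y gap = []
    chain-labels (suc k) x x≤y gap = label ∷ chain-labels k cover cover≤y cover-gap
      where open Step k x x≤y gap

    chain-labelled : ∀ k x x≤y gap → LabelSeq SegLabel (chain k x x≤y gap) (chain-labels k x x≤y gap)
    chain-labelled zero    x x≤y gap = ls-stop
    chain-labelled (suc k) x x≤y gap = ls-step labelled (chain-labelled k cover cover≤y cover-gap)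
      where open Step k x x≤y gap

    chain-increasing : ∀ k x x≤y gap → Increasing (chain-labels k x x≤y gap)
    chain-increasing zero          x x≤y gap = tt
    chain-increasing (suc zero)    x x≤y gap = tt
    chain-increasing (suc (suc k)) x x≤y gap =
      label-<L-next greedy (Step.greedy k cover cover≤y cover-gap) ,
      chain-increasing (suc k) cover cover≤y cover-gap
      where open Step (suc k) x x≤y gap

    no-step-at-top : ∀ x x′ {w} → x ≐S x′ → x ≤S y → dim y ≡ dim x → x′ ⋖S w → Chain w y → ⊥
    no-step-at-top x x′ {w} (x≤x′ , _) x≤y dy≡dx x′⋖w w→y =
      proj₂ (proj₁ x′⋖w) (≤S-trans w x x′ (≤S-trans w y x (Chain⇒≤S w→y) y≤x) x≤x′)
      where
      y≤x : y ≤S x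
      y≤x = dim-≤⇒≥S x y x≤y (ℕ.≤-reflexive dy≡dx)

    no-stop-below-top : ∀ k x x′ → x ≐S x′ → dim y ≡ suc k ℕ.+ dim x → ¬ y ≤S x′
    no-stop-below-top k x x′ (x≤x′ , x′≤x) gap y≤x′ =
      ℕ.<⇒≱ (gap⇒< k x gap) (dim-monoS y x (≤S-trans y x′ x y≤x′ x′≤x))

    chain-unique : ∀ k x x′ → x ≐S x′ → (x≤y : x ≤S y) (gap : dim y ≡ k ℕ.+ dim x) →
                   (ch : Chain x′ y) {ls : List Label} → LabelSeq SegLabel ch ls → Increasing ls →
                   SameChain (chain k x x≤y gap) ch
    chain-unique zero    x x′ x≐x′ x≤y gap (stop _)            _ _ = lift tt
    chain-unique zero    x x′ x≐x′ x≤y gap (step w x′⋖w w→y) _ _ =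
      ⊥-elim (no-step-at-top x x′ x≐x′ x≤y gap x′⋖w w→y)
    chain-unique (suc k) x x′ x≐x′ x≤y gap (stop (_ , y≤x′)) _ _ =
      ⊥-elim (no-stop-below-top k x x′ x≐x′ gap y≤x′)
    chain-unique (suc k) x x′ x≐x′ x≤y gap
                 ch@(step w x′⋖w w→y) lseq@(ls-step {a = a′} labelled′ rest-labelled) incr =
      cover≐w , chain-unique k cover w cover≐w cover≤y cover-gap w→y rest-labelled (Increasing-tail _ incr)
      where
      open Step k x x≤y gap
      label≗a′ : label ≗L a′
      label≗a′ i = Fin.≤-antisym (label-≤L greedy x′ w (proj₁ x≐x′) (Chain⇒≤S w→y) labelled′ i)
                                 (increasing-≥L greedy (proj₂ x≐x′) ch lseq incr i)
      cover≐w : cover ≐S w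
      cover≐w = cover-≐S greedy x′ w x≐x′ x′⋖w (Chain⇒≤S w→y) labelled′ label≗a′

    chain-lex-least : ∀ k x x′ → x ≐S x′ → (x≤y : x ≤S y) (gap : dim y ≡ k ℕ.+ dim x) →
                      (ch : Chain x′ y) {ls : List Label} → LabelSeq SegLabel ch ls →
                      ¬ SameChain (chain k x x≤y gap) ch → LexLt (chain-labels k x x≤y gap) ls
    chain-lex-least zero    x x′ x≐x′ x≤y gap (stop _)          _ different = ⊥-elim (different (lift tt))
    chain-lex-least zero    x x′ x≐x′ x≤y gap (step w x′⋖w w→y) _ _ =
      ⊥-elim (no-step-at-top x x′ x≐x′ x≤y gap x′⋖w w→y)
    chain-lex-least (suc k) x x′ x≐x′ x≤y gap (stop (_ , y≤x′)) _ _ =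
      ⊥-elim (no-stop-below-top k x x′ x≐x′ gap y≤x′)
    chain-lex-least (suc k) x x′ x≐x′ x≤y gap
                    (step w x′⋖w w→y) (ls-step {a = a′} labelled′ rest-labelled) different =
      by-first-label (Fin.all? (λ i → label i Fin.≟ a′ i))
      where
      open Step k x x≤y gap
      by-first-label : Dec (label ≗L a′) → LexLt (chain-labels (suc k) x x≤y gap) (a′ ∷ _)
      by-first-label (yes label≗a′) = next label≗a′
        (chain-lex-least k cover w cover≐w cover≤y cover-gap w→y rest-labelled (different ∘ (cover≐w ,_)))
        where
        cover≐w : cover ≐S w
        cover≐w = cover-≐S greedy x′ w x≐x′ x′⋖w (Chain⇒≤S w→y) labelled′ label≗a′
      by-first-label (no label≉a′) =
        this (label-≤L greedy x′ w (proj₁ x≐x′) (Chain⇒≤S w→y) labelled′ , label≉a′)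

  segLabel-isELLabeling : IsELLabeling SegLabel
  segLabel-isELLabeling x y x≤y =
    chain k x x≤y gap , chain-labels k x x≤y gap , chain-labelled k x x≤y gap , chain-increasing k x x≤y gap ,
    (λ ch ls labelled incr → chain-unique k x x (≤S-refl x , ≤S-refl x) x≤y gap ch labelled incr) ,
    (λ ch ls labelled different → chain-lex-least k x x (≤S-refl x , ≤S-refl x) x≤y gap ch labelled different)
    where
    open GreedyChain y
    k : ℕ
    k = dim y ℕ.∸ dim x
    gap : dim y ≡ k ℕ.+ dim x
    gap = ≡.sym (ℕ.m∸n+n≡m (dim-monoS x y x≤y))

proposition3p3 : ∀ {c ℓ} (q : ℕ) → IsPrimePower q →
    (F : FiniteField c ℓ) → FiniteField.size F ≡ q →
    (n t : ℕ) → 1 ≤ n → 1 ≤ t →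
    Over.IsELLabeling F n t (Over.SegLabel F n t)
proposition3p3 q _ F _ n t _ 1≤t = SegrePower.segLabel-isELLabeling F n t (fromℕ< 1≤t)
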